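{- Let $k\ge 2$ and $n\ge 1$, let $t=t_1\cdots t_i$ be a traversal string with $1\le i\le n$, and let $1\le x\le k^{n-i}$. Define $R(t,x)=\big((k+1-t_1)(k+1-t_2)\cdots(k+1-t_i),\ k^{n-i}+1-x\big)$. Then \[b(t,x)=k^n+1-a(R(t,x)).\]
   Context: The infinite rooted directed $k$-ary tree: every vertex has $k$ children ordered from leftmost (1st) to rightmost ($k$th); the root is on layer 1. A traversal string $t=t_1\cdots t_i$ with $t_\ell\in\{1,\dots,k\}$ determines the vertex $v_t$ on layer $i+1$ reached from the root by moving at step $\ell$ to the $t_\ell$-th leftmost child. Labeled chip-firing: initially chips labeled $1,\dots,k^n$ are on the root; a vertex holding at least $k$ chips may fire by choosing any $k$ of its chips and sending the chip with the $r$-th smallest label to its $r$-th leftmost child ($r=1,\dots,k$); a firing strategy is any sequence of such choices. Exactly $k^{n-i}$ chips arrive at each vertex of layer $i+1$. For $t$ of length $i$ and $1\le x\le k^{n-i}$, a chip $c$ can land at the landing order $(t,x)$ if under some strategy $c$ is the $x$-th smallest of the chips arriving at $v_t$; $a(t,x)$ and $b(t,x)$ are the smallest and largest chips that can land at $(t,x)$. $R(t,x)$ is the landing order mirror-symmetric to $(t,x)$. -}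

module Defs where

open import Data.Nat as ℕ using (ℕ; zero; suc; _+_; _∸_; _^_)
open import Data.Fin as Fin using (Fin; toℕ; opposite)
open import Data.List using (List; []; _∷_; _++_; [_]; length; filter; map)
open import Data.List.Properties using (≡-dec)
open import Data.List.Membership.Propositional using (_∈_)
import Data.List.Membership.DecPropositional as DecMem
open import Data.Product using (Σ; _×_)
open import Relation.Binary.PropositionalEquality using (_≡_; _≢_)
open import Relation.Nullary.Decidable using (Dec; _×-dec_)

open import Data.List using (allFin) public

-- A vertex of the infinite k-ary tree, given by its traversal string from the
-- root; the letter r : Fin k means "go to the (toℕ r + 1)-th leftmost child".
Pos : ℕ → Set
Pos k = List (Fin k)

_≟P_ : ∀ {k} (p q : Pos k) → Dec (p ≡ q)
_≟P_ = ≡-dec Fin._≟_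

-- Chips: c : Fin (k ^ n) is the chip with label toℕ c + 1 (labels 1..k^n).
Chip : ℕ → ℕ → Set
Chip k n = Fin (k ^ n)

label : ∀ {m} → Fin m → ℕ
label c = suc (toℕ c)

-- Mirror of a traversal string: t_ℓ ↦ k + 1 - t_ℓ.
mirror : ∀ {k} → Pos k → Pos k
mirror = map opposite

IsLeast : ∀ {m} → (Fin m → Set) → Fin m → Set
IsLeast P a = P a × (∀ c → P c → a Fin.≤ c)

IsGreatest : ∀ {m} → (Fin m → Set) → Fin m → Set
IsGreatest P b = P b × (∀ c → P c → c Fin.≤ b)

module ChipFiring (k n : ℕ) where

  Config : Set
  Config = Chip k n → Pos k

  initial : Config
  initial _ = []

  chipsAt : Config → Pos k → ℕ
  chipsAt σ v = length (filter (λ c → σ c ≟P v) (allFin (k ^ n)))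

  record Fire (σ σ' : Config) : Set where
    field
      v     : Pos k
      f     : Fin k → Chip k n
      incr  : ∀ {r s} → r Fin.< s → f r Fin.< f s
      atv   : ∀ r → σ (f r) ≡ v
      moved : ∀ r → σ' (f r) ≡ v ++ [ r ]
      rest  : ∀ c → (∀ r → f r ≢ c) → σ' c ≡ σ c

  Stable : Config → Set
  Stable σ = ∀ v → chipsAt σ v ℕ.< k

  data Run (σ : Config) : Set where
    done : Stable σ → Run σ
    fire : ∀ {σ'} → Fire σ σ' → Run σ' → Run σ

  visits : ∀ {σ} → Run σ → Chip k n → List (Pos k)
  visits {σ} (done _)   c = σ c ∷ []
  visits {σ} (fire _ r) c = σ c ∷ visits r c

  Arrives : ∀ {σ} → Run σ → Chip k n → Pos k → Set
  Arrives r c t = t ∈ visits r c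

  arrivalsBelow : ∀ {σ} → Run σ → Pos k → Chip k n → ℕ
  arrivalsBelow r t c =
    length (filter (λ d → (d Fin.<? c) ×-dec (t ∈? visits r d)) (allFin (k ^ n)))
    where open DecMem (_≟P_ {k}) using (_∈?_)

  LandsAt : ∀ {σ} → Run σ → Pos k → ℕ → Chip k n → Set
  LandsAt r t x c = Arrives r c t × suc (arrivalsBelow r t c) ≡ x

  CanLand : Pos k → ℕ → Chip k n → Set
  CanLand t x c = Σ (Run initial) λ r → LandsAt r t x c

CanLand : (k n : ℕ) → Pos k → ℕ → Chip k n → Set
CanLand k n = ChipFiring.CanLand k n

-- Whenever a vertex fires, one chip goes to each child, in increasing order of labels.
-- Hence the chips that ever enter child j of a vertex inject into those entering child s,
-- with smaller labels if s < j and larger ones if s > j.  If c lands x-th at v_t, then x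
-- chips of label ≤ c arrive at v_t, and applying these injections along t shows that at
-- least x t₁ ⋯ tᵢ chips have label ≤ c.  Dually, at least k^(n-i) chips arrive at v_t
-- (every vertex of the final configuration holds fewer than k chips), so at least
-- (k^(n-i) + 1 - x) (k + 1 - t₁) ⋯ (k + 1 - tᵢ) chips have label ≥ c.  Both bounds are
-- attained: a vertex can fire so that the chips it sends to its first s children in its
-- first r firings are the s r smallest (or largest) of its chips.  Thus
-- a(t,x) = x ∏ t_ℓ and k^n + 1 - b(t,x) = (k^(n-i) + 1 - x) ∏ (k + 1 - t_ℓ) = a(R(t,x)).

module Submission where

open import Defs
open import Data.Nat using (ℕ; _+_; _∸_; _^_; _≤_)
open import Data.List using (List; length)
open import Data.Fin using (Fin)
open import Data.Product using (Σ; _×_)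
open import Relation.Binary.PropositionalEquality using (_≡_)

open import Data.Empty using (⊥; ⊥-elim)
open import Data.Fin as Fin using (zero; suc; toℕ; fromℕ<; combine; remQuot; opposite)
open import Data.Fin.Properties as Fin using (toℕ-injective; toℕ<n; toℕ-fromℕ<)
open import Data.List using ([]; _∷_; _++_; [_]; map; filter; tabulate)
open import Data.Nat.ListAction using (sum; product)
import Data.List.Properties as List
open import Data.List.Membership.Propositional using (_∈_)
open import Data.List.Relation.Unary.Any using (Any; here; there)
import Data.List.Relation.Unary.Any as Any
import Data.List.Relation.Unary.All as All
open import Data.List.Relation.Unary.Unique.Propositional using (Unique)
import Data.List.Relation.Unary.Unique.Propositional.Properties as Unique
open import Data.List.Relation.Unary.AllPairs using ([]; _∷_)
open import Data.List.Membership.Propositional.Properties using (∈-filter⁻; ∈-allFin)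
open import Data.List.Relation.Binary.Pointwise using (Pointwise-≡⇒≡)
open import Data.List.Relation.Binary.Prefix.Heterogeneous using (Prefix; []; _∷_; _++ᵖ_)
import Data.List.Relation.Binary.Prefix.Heterogeneous.Properties as Prefix
open import Data.Nat as ℕ using (zero; suc; _*_; _<_; z≤n; s≤s; s<s; s≤s⁻¹; s<s⁻¹; >-nonZero)
open import Data.Nat.Properties
open import Data.Nat.DivMod using (_%_; [m+kn]%n≡m%n; m<n⇒m%n≡m)
open import Algebra.Properties.CommutativeSemigroup +-commutativeSemigroup using (interchange)
open import Data.Product using (_,_; proj₁; proj₂; ∃; uncurry)
import Data.Product
open import Data.Sum using (_⊎_; inj₁; inj₂)
import Data.Sum
open import Function using (_∘_; id)
open import Function.Definitions using (Injective)
open import Level using (0ℓ)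
open import Relation.Binary.PropositionalEquality using (_≢_; _≗_; refl; sym; trans; cong; cong₂; subst; subst₂; module ≡-Reasoning)
open import Relation.Nullary using (Dec; yes; no; ¬_; contradiction)
open import Relation.Nullary.Decidable using (does; toSum; _×-dec_; dec-true; dec-false)
open import Data.Bool using (if_then_else_)
open import Relation.Binary using (tri<; tri≈; tri>)
open import Relation.Unary using (Pred; Decidable; U; _⊆_; _∪_; _∩_; ∁; _≐_)
open import Relation.Unary.Properties using (_∩?_; ∁?; U?)

private variable
  X Y Z : Set
  M : ℕ

indicator : Dec X → ℕ
indicator (yes _) = 1
indicator (no _)  = 0

FinPred : ℕ → Set₁
FinPred M = Pred (Fin M) 0ℓ

count : {P : FinPred M} → Decidable P → ℕ
count {zero}  P? = 0
count {suc M} P? = indicator (P? zero) + count (P? ∘ suc)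

length-filter-tabulate : {P : Pred X 0ℓ} (P? : Decidable P) (f : Fin M → X) →
                         length (filter P? (tabulate f)) ≡ count (P? ∘ f)
length-filter-tabulate {M = zero}  P? f = refl
length-filter-tabulate {M = suc M} P? f with P? (f zero)
... | yes _ = cong suc (length-filter-tabulate P? (f ∘ suc))
... | no _  = length-filter-tabulate P? (f ∘ suc)

length-filter-allFin : {P : FinPred M} (P? : Decidable P) → length (filter P? (allFin M)) ≡ count P?
length-filter-allFin P? = length-filter-tabulate P? id

indicator≤1 : (a? : Dec X) → indicator a? ≤ 1
indicator≤1 (yes _) = ≤-refl
indicator≤1 (no _)  = z≤n

indicator-mono : (a? : Dec X) (b? : Dec Y) → (X → Y) → indicator a? ≤ indicator b?
indicator-mono (yes a) (yes _) _   = ≤-refl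
indicator-mono (yes a) (no ¬b) a→b = contradiction (a→b a) ¬b
indicator-mono (no _)  _       _   = z≤n

indicator-partition : (c? : Dec Z) (a? : Dec X) (b? : Dec Y) → (Z → X ⊎ Y) → (X ⊎ Y → Z) → (X → Y → ⊥) →
                      indicator c? ≡ indicator a? + indicator b?
indicator-partition _       (yes a) (yes b) _   _   disj = ⊥-elim (disj a b)
indicator-partition (yes _) (yes _) (no _)  _   _   _    = refl
indicator-partition (yes _) (no _)  (yes _) _   _   _    = refl
indicator-partition (yes c) (no ¬a) (no ¬b) c→  _   _    with c→ c
... | inj₁ a = contradiction a ¬a
... | inj₂ b = contradiction b ¬b
indicator-partition (no ¬c) (yes a) _       _   →c  _    = contradiction (→c (inj₁ a)) ¬c
indicator-partition (no ¬c) (no _)  (yes b) _   →c  _    = contradiction (→c (inj₂ b)) ¬c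
indicator-partition (no _)  (no _)  (no _)  _   _   _    = refl

count-mono : ∀ {M} {P Q : FinPred M} (P? : Decidable P) (Q? : Decidable Q) → P ⊆ Q → count P? ≤ count Q?
count-mono {zero}  _  _  _   = z≤n
count-mono {suc M} P? Q? P⊆Q =
  +-mono-≤ (indicator-mono (P? zero) (Q? zero) P⊆Q) (count-mono (P? ∘ suc) (Q? ∘ suc) P⊆Q)

count-cong : ∀ {P Q : FinPred M} (P? : Decidable P) (Q? : Decidable Q) → P ≐ Q → count P? ≡ count Q?
count-cong P? Q? (P⊆Q , Q⊆P) = ≤-antisym (count-mono P? Q? P⊆Q) (count-mono Q? P? Q⊆P)

count≤size : ∀ {M} {P : FinPred M} (P? : Decidable P) → count P? ≤ M
count≤size {zero}  P? = z≤n
count≤size {suc M} P? = +-mono-≤ (indicator≤1 (P? zero)) (count≤size (P? ∘ suc))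

count<size : ∀ {M} {P : FinPred M} (P? : Decidable P) (c : Fin M) → ¬ P c → count P? < M
count<size P? zero    ¬Pc with P? zero
... | yes Pc = contradiction Pc ¬Pc
... | no _   = s≤s (count≤size (P? ∘ suc))
count<size P? (suc c) ¬Pc = +-mono-≤-< (indicator≤1 (P? zero)) (count<size (P? ∘ suc) c ¬Pc)

count-all : ∀ {M} {P : FinPred M} (P? : Decidable P) → (∀ c → P c) → count P? ≡ M
count-all {zero}  P? all = refl
count-all {suc M} P? all with P? zero
... | yes _  = cong suc (count-all (P? ∘ suc) (all ∘ suc))
... | no ¬P0 = contradiction (all zero) ¬P0

count-none : ∀ {M} {P : FinPred M} (P? : Decidable P) → (∀ c → ¬ P c) → count P? ≡ 0
count-none {zero}  P? none = refl
count-none {suc M} P? none with P? zero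
... | yes P0 = contradiction P0 (none zero)
... | no _   = count-none (P? ∘ suc) (none ∘ suc)

count-partition : ∀ {M} {P Q R : FinPred M} (R? : Decidable R) (P? : Decidable P) (Q? : Decidable Q) →
                  R ≐ P ∪ Q → (∀ {c} → P c → Q c → ⊥) → count R? ≡ count P? + count Q?
count-partition {zero}  _  _  _  _                _    = refl
count-partition {suc M} R? P? Q? (R⊆ , ⊆R) disj =
  trans (cong₂ _+_ (indicator-partition (R? zero) (P? zero) (Q? zero) R⊆ ⊆R disj)
                   (count-partition (R? ∘ suc) (P? ∘ suc) (Q? ∘ suc) (R⊆ , ⊆R) disj))
        (interchange (indicator (P? zero)) _ _ _)

count-single : ∀ {M} (y : Fin M) → count (Fin._≟ y) ≡ 1
count-single {suc M} zero    = cong suc (count-none {M} {λ c → suc c ≡ zero} (λ c → suc c Fin.≟ zero) (λ _ ()))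
count-single {suc M} (suc y) =
  trans (count-cong (λ c → suc c Fin.≟ suc y) (Fin._≟ y) (Fin.suc-injective , cong suc)) (count-single y)

count-atMostOne : ∀ {P : FinPred M} (P? : Decidable P) → (∀ {c d} → P c → P d → c ≡ d) → count P? ≤ 1
count-atMostOne P? unique with Fin.any? P?
... | yes (c , Pc) = ≤-reflexive (trans (count-cong P? (Fin._≟ c) ((λ Pd → unique Pd Pc) , λ { refl → Pc }))
                                       (count-single c))
... | no ∄P = ≤-trans (≤-reflexive (count-none P? (λ c Pc → ∄P (c , Pc)))) z≤n

count-injection : ∀ {M N} {P : FinPred M} {Q : FinPred N} (P? : Decidable P) (Q? : Decidable Q) (f : Fin M → Fin N) →
                  (∀ {c} → P c → Q (f c)) → (∀ {c d} → P c → P d → f c ≡ f d → c ≡ d) → count P? ≤ count Q?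
count-injection {zero}  _  _  _ _    _   = z≤n
count-injection {suc M} {P = P} {Q} P? Q? f into inj with P? zero
... | no _   = count-injection (P? ∘ suc) Q? (f ∘ suc) into (λ Pc Pd → Fin.suc-injective ∘ inj Pc Pd)
... | yes P0 = begin
  suc (count (P? ∘ suc))                ≤⟨ s≤s (count-injection (P? ∘ suc) Q-f0? (f ∘ suc) into′ inj′) ⟩
  suc (count Q-f0?)                     ≡⟨ cong (_+ count Q-f0?) (count-single (f zero)) ⟨
  count (Fin._≟ f zero) + count Q-f0?   ≡⟨ count-partition Q? (Fin._≟ f zero) Q-f0? Q≐ disjoint ⟨
  count Q?                              ∎
  where
  open ≤-Reasoning
  Q-f0? = Q? ∩? ∁? (Fin._≟ f zero)
  into′ : ∀ {c} → P (suc c) → Q (f (suc c)) × ¬ f (suc c) ≡ f zero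
  into′ Pc = into Pc , λ eq → Fin.0≢1+n (sym (inj Pc P0 eq))
  inj′ : ∀ {c d} → P (suc c) → P (suc d) → f (suc c) ≡ f (suc d) → c ≡ d
  inj′ Pc Pd = Fin.suc-injective ∘ inj Pc Pd
  Q≐ : Q ≐ (_≡ f zero) ∪ (Q ∩ ∁ (_≡ f zero))
  Q≐ = split , λ { (inj₁ refl) → into P0 ; (inj₂ (Qc , _)) → Qc }
    where
    split : ∀ {c} → Q c → c ≡ f zero ⊎ (Q c × ¬ c ≡ f zero)
    split {c} Qc = Data.Sum.map₂ (Qc ,_) (toSum (c Fin.≟ f zero))
  disjoint : ∀ {c} → c ≡ f zero → Q c × ¬ c ≡ f zero → ⊥
  disjoint eq (_ , c≢) = c≢ eq

≤⇒<⊎≡ : ∀ {M} {d c : Fin M} → d Fin.≤ c → d Fin.< c ⊎ d ≡ c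
≤⇒<⊎≡ d≤c = Data.Sum.map₂ toℕ-injective (m≤n⇒m<n∨m≡n d≤c)

<⊎≡⇒≤ : ∀ {M} {d c : Fin M} → d Fin.< c ⊎ d ≡ c → d Fin.≤ c
<⊎≡⇒≤ (inj₁ d<c) = <⇒≤ d<c
<⊎≡⇒≤ (inj₂ refl) = ≤-refl

<⊎≥ : ∀ {M} (d c : Fin M) → d Fin.< c ⊎ c Fin.≤ d
<⊎≥ d c = Data.Sum.map₂ ≮⇒≥ (toSum (d Fin.<? c))

count-below : ∀ {M} (c : Fin M) → count {M} (Fin._<? c) ≡ toℕ c
count-below {suc M} zero    = count-none {suc M} (Fin._<? zero {M}) (λ d → n≮0)
count-below {suc M} (suc c) =
  cong suc (trans (count-cong {M} (λ d → suc d Fin.<? suc c) (Fin._<? c) (s<s⁻¹ , s<s)) (count-below c))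

count-atMost : ∀ {M} (c : Fin M) → count {M} (Fin._≤? c) ≡ suc (toℕ c)
count-atMost {M} c = begin
  count {M} (Fin._≤? c)
    ≡⟨ count-partition (Fin._≤? c) (Fin._<? c) (Fin._≟ c) (≤⇒<⊎≡ , <⊎≡⇒≤) disjoint ⟩
  count {M} (Fin._<? c) + count (Fin._≟ c)  ≡⟨ cong₂ _+_ (count-below c) (count-single c) ⟩
  toℕ c + 1                                 ≡⟨ +-comm (toℕ c) 1 ⟩
  suc (toℕ c)                               ∎
  where
  open ≡-Reasoning
  disjoint : ∀ {d} → d Fin.< c → d ≡ c → ⊥
  disjoint d<c refl = n≮n _ d<c

count-atLeast : ∀ {M} (c : Fin M) → count {M} (c Fin.≤?_) ≡ M ∸ toℕ c
count-atLeast {M} c = begin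
  count {M} (c Fin.≤?_)
    ≡⟨ m+n∸m≡n (toℕ c) _ ⟨
  toℕ c + count {M} (c Fin.≤?_) ∸ toℕ c
    ≡⟨ cong (λ b → b + count {M} (c Fin.≤?_) ∸ toℕ c) (count-below c) ⟨
  count {M} (Fin._<? c) + count {M} (c Fin.≤?_) ∸ toℕ c
    ≡⟨ cong (_∸ toℕ c) (count-partition {M} U? (Fin._<? c) (c Fin.≤?_) ((λ {d} _ → <⊎≥ d c) , _) <⇒≱) ⟨
  count {M} U? ∸ toℕ c
    ≡⟨ cong (_∸ toℕ c) (count-all U? _) ⟩
  M ∸ toℕ c
    ∎
  where
  open ≡-Reasoning

count-strict : ∀ {P Q : FinPred M} (P? : Decidable P) (Q? : Decidable Q) (c : Fin M) →
               P ⊆ Q → Q c → ¬ P c → count P? < count Q?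
count-strict {P = P} {Q} P? Q? c P⊆Q Qc ¬Pc = begin-strict
  count P?               <⟨ m<m+n (count P?) c∈Q∖P ⟩
  count P? + count Q∖P?  ≡⟨ count-partition Q? P? Q∖P? (split , join) (λ Pd (_ , ¬Pd) → ¬Pd Pd) ⟨
  count Q?               ∎
  where
  open ≤-Reasoning
  Q∖P? = Q? ∩? ∁? P?
  c∈Q∖P : 1 ≤ count Q∖P?
  c∈Q∖P = subst (_≤ count Q∖P?) (count-single c) (count-mono (Fin._≟ c) Q∖P? (λ { refl → Qc , ¬Pc }))
  split : ∀ {d} → Q d → P d ⊎ (Q d × ¬ P d)
  split {d} Qd = Data.Sum.map₂ (Qd ,_) (toSum (P? d))
  join : ∀ {d} → P d ⊎ (Q d × ¬ P d) → Q d
  join (inj₁ Pd)       = P⊆Q Pd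
  join (inj₂ (Qd , _)) = Qd

count-key< : ∀ {M} (key : Fin M → ℕ) → Injective _≡_ _≡_ key → ∀ N → count (λ c → key c <? N) ≤ N
count-key< key inj zero    = ≤-reflexive (count-none (λ c → key c <? 0) (λ _ → n≮0))
count-key< key inj (suc N) = begin
  count (λ c → key c <? suc N)
    ≡⟨ count-partition _ (λ c → key c <? N) (λ c → key c ℕ.≟ N) (m<1+n⇒m<n∨m≡n , join) <⇒≢ ⟩
  count (λ c → key c <? N) + count (λ c → key c ℕ.≟ N)
    ≤⟨ +-mono-≤ (count-key< key inj N) (count-atMostOne _ (λ p q → inj (trans p (sym q)))) ⟩
  N + 1
    ≡⟨ +-comm N 1 ⟩
  suc N
    ∎
  where
  open ≤-Reasoning
  join : ∀ {m} → m < N ⊎ m ≡ N → m < suc N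
  join (inj₁ m<N)  = m<n⇒m<1+n m<N
  join (inj₂ refl) = ≤-refl

injective⇒surjective : ∀ {M} (f : Fin M → Fin M) → Injective _≡_ _≡_ f → ∀ c → ∃ λ p → f p ≡ c
injective⇒surjective {M} f inj c with Fin.any? (λ p → f p Fin.≟ c)
... | yes found = found
... | no  ∄p    = contradiction (count<size image? c ∄p) (≤⇒≯ (begin
  M              ≡⟨ count-all U? _ ⟨
  count {M} U?   ≤⟨ count-injection U? image? f (λ {p} _ → p , refl) (λ _ _ → inj) ⟩
  count image?   ∎))
  where
  open ≤-Reasoning
  image? = λ d → Fin.any? (λ p → f p Fin.≟ d)

module Ranking {N} (key : Fin N → ℕ) (key-injective : Injective _≡_ _≡_ key) where

  rank : Fin N → Fin N
  rank p = fromℕ< (count<size (λ q → key q <? key p) p (n≮n (key p)))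

  toℕ-rank : ∀ p → toℕ (rank p) ≡ count (λ q → key q <? key p)
  toℕ-rank p = toℕ-fromℕ< _

  rank-mono : ∀ {p q} → key p < key q → rank p Fin.< rank q
  rank-mono {p} {q} p<q = subst₂ _<_ (sym (toℕ-rank p)) (sym (toℕ-rank q))
    (count-strict (λ r → key r <? key p) (λ r → key r <? key q) p (λ r<p → <-trans r<p p<q) p<q (n≮n (key p)))

  rank≤key : ∀ p → toℕ (rank p) ≤ key p
  rank≤key p = subst (_≤ key p) (sym (toℕ-rank p)) (count-key< key key-injective (key p))

  rank-injective : Injective _≡_ _≡_ rank
  rank-injective {p} {q} eq with <-cmp (key p) (key q)
  ... | tri< p<q _ _ = contradiction (cong toℕ eq) (<⇒≢ (rank-mono p<q))
  ... | tri≈ _ p≡q _ = key-injective p≡q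
  ... | tri> _ _ q<p = contradiction (cong toℕ eq) (>⇒≢ (rank-mono q<p))

  unrank : Fin N → Fin N
  unrank c = proj₁ (injective⇒surjective rank rank-injective c)

  rank-unrank : ∀ c → rank (unrank c) ≡ c
  rank-unrank c = proj₂ (injective⇒surjective rank rank-injective c)

  unrank-rank : ∀ p → unrank (rank p) ≡ p
  unrank-rank p = rank-injective (rank-unrank (rank p))

record MonotonePairing (k K : ℕ) : Set where
  field
    to      : Fin k → Fin K → Fin (k * K)
    from    : Fin (k * K) → Fin k × Fin K
    from-to : ∀ s m → from (to s m) ≡ (s , m)
    to-from : ∀ c → uncurry to (from c) ≡ c
    monoˡ   : ∀ {s s' m} → s Fin.< s' → to s m Fin.< to s' m
    monoʳ   : ∀ {s m m'} → m Fin.< m' → to s m Fin.< to s m'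

  to-injectiveʳ : ∀ s {m m'} → to s m ≡ to s m' → m ≡ m'
  to-injectiveʳ s {m} {m'} eq = cong proj₂ (trans (sym (from-to s m)) (trans (cong from eq) (from-to s m')))

  monoʳ⁻¹ : ∀ {s m m'} → to s m Fin.< to s m' → m Fin.< m'
  monoʳ⁻¹ {s} {m} {m'} lt with Fin.<-cmp m m'
  ... | tri< m<m' _ _ = m<m'
  ... | tri≈ _ refl _ = contradiction lt (n≮n _)
  ... | tri> _ _ m'<m = contradiction lt (<-asym (monoʳ m'<m))

  from-injective : ∀ {c c'} → from c ≡ from c' → c ≡ c'
  from-injective {c} {c'} eq = trans (sym (to-from c)) (trans (cong (uncurry to) eq) (to-from c'))

module KeyPairing {k K} (key : Fin k → Fin K → ℕ)
         (key-injective : ∀ {s m s' m'} → key s m ≡ key s' m' → s ≡ s' × m ≡ m')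
         (key-monoˡ : ∀ {s s' m} → s Fin.< s' → key s m < key s' m)
         (key-monoʳ : ∀ {s m m'} → m Fin.< m' → key s m < key s m') where

  private
    key′ : Fin (k * K) → ℕ
    key′ = uncurry key ∘ remQuot {k} K

    key′-combine : ∀ s m → key′ (combine s m) ≡ key s m
    key′-combine s m = cong (uncurry key) (Fin.remQuot-combine s m)

    key′-injective : Injective _≡_ _≡_ key′
    key′-injective {p} {q} eq =
      trans (sym (Fin.combine-remQuot {k} K p))
            (trans (uncurry (cong₂ combine) (key-injective eq)) (Fin.combine-remQuot {k} K q))

    open Ranking key′ key′-injective

    rank-combine-mono : ∀ {s m s' m'} → key s m < key s' m' → rank (combine s m) Fin.< rank (combine s' m')
    rank-combine-mono {s} {m} {s'} {m'} lt =
      rank-mono (subst₂ _<_ (sym (key′-combine s m)) (sym (key′-combine s' m')) lt)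

  pairing : MonotonePairing k K
  pairing = record
    { to      = λ s m → rank (combine s m)
    ; from    = remQuot {k} K ∘ unrank
    ; from-to = λ s m → trans (cong (remQuot {k} K) (unrank-rank (combine s m))) (Fin.remQuot-combine s m)
    ; to-from = λ c → trans (cong rank (Fin.combine-remQuot {k} K (unrank c))) (rank-unrank c)
    ; monoˡ   = rank-combine-mono ∘ key-monoˡ
    ; monoʳ   = rank-combine-mono ∘ key-monoʳ
    }

  to≤key : ∀ s m → toℕ (MonotonePairing.to pairing s m) ≤ key s m
  to≤key s m = subst (toℕ (rank (combine s m)) ≤_) (key′-combine s m) (rank≤key (combine s m))

*+-injective : ∀ A {m m' s s'} → s < A → s' < A → A * m + s ≡ A * m' + s' → m ≡ m' × s ≡ s'
*+-injective A {m} {m'} {s} {s'} s<A s'<A eq = m≡m' , s≡s'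
  where
  instance
    _ = >-nonZero (≤-<-trans z≤n s<A)
  remainder : ∀ {q r} → r < A → (A * q + r) % A ≡ r
  remainder {q} {r} r<A = begin
    (A * q + r) % A  ≡⟨ cong (_% A) (trans (+-comm (A * q) r) (cong (r +_) (*-comm A q))) ⟩
    (r + q * A) % A  ≡⟨ [m+kn]%n≡m%n r q A ⟩
    r % A            ≡⟨ m<n⇒m%n≡m r<A ⟩
    r                ∎
    where open ≡-Reasoning
  s≡s' : s ≡ s'
  s≡s' = trans (sym (remainder s<A)) (trans (cong (_% A) eq) (remainder s'<A))
  m≡m' : m ≡ m'
  m≡m' = *-cancelˡ-≡ m m' A (+-cancelʳ-≡ _ _ _ (trans eq (cong (A * m' +_) (sym s≡s'))))

m*n+o<m*[1+n] : ∀ A {m s} → s < A → A * m + s < A * suc m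
m*n+o<m*[1+n] A {m} {s} s<A = begin-strict
  A * m + s  <⟨ +-monoʳ-< (A * m) s<A ⟩
  A * m + A  ≡⟨ +-comm (A * m) A ⟩
  A + A * m  ≡⟨ *-suc A m ⟨
  A * suc m  ∎
  where open ≤-Reasoning

combine-monoˡ-< : ∀ {k K} {s s' : Fin k} (m m' : Fin K) → s Fin.< s' → combine s m Fin.< combine s' m'
combine-monoˡ-< {K = K} {s} {s'} m m' s<s' = begin-strict
  toℕ (combine s m)      ≡⟨ Fin.toℕ-combine s m ⟩
  K * toℕ s + toℕ m      <⟨ m*n+o<m*[1+n] K (toℕ<n m) ⟩
  K * suc (toℕ s)        ≤⟨ *-monoʳ-≤ K s<s' ⟩
  K * toℕ s'             ≤⟨ m≤m+n (K * toℕ s') (toℕ m') ⟩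
  K * toℕ s' + toℕ m'    ≡⟨ Fin.toℕ-combine s' m' ⟨
  toℕ (combine s' m')    ∎
  where open ≤-Reasoning

combine-monoʳ-< : ∀ {k K} (s : Fin k) {m m' : Fin K} → m Fin.< m' → combine s m Fin.< combine s m'
combine-monoʳ-< {K = K} s {m} {m'} m<m' =
  subst₂ _<_ (sym (Fin.toℕ-combine s m)) (sym (Fin.toℕ-combine s m')) (+-monoʳ-< (K * toℕ s) m<m')

module Corner {k K} (a : Fin k) (b : Fin K) where

  InCorner : Fin k → Fin K → Set
  InCorner s m = s Fin.≤ a × m Fin.≤ b

  inCorner? : ∀ s m → Dec (InCorner s m)
  inCorner? s m = (s Fin.≤? a) ×-dec (m Fin.≤? b)

  -- The pairs of the rectangle [0,a] × [0,b] come first, ordered so that (a , b) is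
  -- the last of them; the other pairs follow in lexicographic order.
  key : Fin k → Fin K → ℕ
  key s m with inCorner? s m
  ... | yes _ = suc (toℕ a) * toℕ m + toℕ s
  ... | no _  = suc (toℕ a) * suc (toℕ b) + toℕ (combine s m)

  private
    A : ℕ
    A = suc (toℕ a)

    inner<outer : ∀ {s m} → InCorner s m → ∀ x → A * toℕ m + toℕ s < A * suc (toℕ b) + x
    inner<outer {s} {m} (s≤a , m≤b) x = begin-strict
      A * toℕ m + toℕ s   <⟨ m*n+o<m*[1+n] A (s≤s s≤a) ⟩
      A * suc (toℕ m)     ≤⟨ *-monoʳ-≤ A (s≤s m≤b) ⟩
      A * suc (toℕ b)     ≤⟨ m≤m+n _ x ⟩
      A * suc (toℕ b) + x ∎
      where open ≤-Reasoning

  key-injective : ∀ {s m s' m'} → key s m ≡ key s' m' → s ≡ s' × m ≡ m'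
  key-injective {s} {m} {s'} {m'} eq with inCorner? s m | inCorner? s' m'
  ... | yes (s≤a , _) | yes (s'≤a , _) =
    let m≡m' , s≡s' = *+-injective A (s≤s s≤a) (s≤s s'≤a) eq in toℕ-injective s≡s' , toℕ-injective m≡m'
  ... | yes inner | no _     = contradiction eq (<⇒≢ (inner<outer inner _))
  ... | no _      | yes inner = contradiction eq (>⇒≢ (inner<outer inner _))
  ... | no _      | no _      = Fin.combine-injective s m s' m' (toℕ-injective (+-cancelˡ-≡ (A * suc (toℕ b)) _ _ eq))

  key-monoˡ : ∀ {s s' m} → s Fin.< s' → key s m < key s' m
  key-monoˡ {s} {s'} {m} s<s' with inCorner? s m | inCorner? s' m
  ... | yes _     | yes _             = +-monoʳ-< (A * toℕ m) s<s'
  ... | yes inner | no _              = inner<outer inner _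
  ... | no outer  | yes (s'≤a , m≤b) = contradiction (≤-trans (<⇒≤ s<s') s'≤a , m≤b) outer
  ... | no _      | no _              = +-monoʳ-< (A * suc (toℕ b)) (combine-monoˡ-< m m s<s')

  key-monoʳ : ∀ {s m m'} → m Fin.< m' → key s m < key s m'
  key-monoʳ {s} {m} {m'} m<m' with inCorner? s m | inCorner? s m'
  ... | yes _     | yes _             = +-monoˡ-< (toℕ s) (*-monoʳ-< A m<m')
  ... | yes inner | no _              = inner<outer inner _
  ... | no outer  | yes (s≤a , m'≤b) = contradiction (s≤a , ≤-trans (<⇒≤ m<m') m'≤b) outer
  ... | no _      | no _              = +-monoʳ-< (A * suc (toℕ b)) (combine-monoʳ-< s m<m')

  -- η-expanded: the implicit arguments cannot be inferred through the with-defined key.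
  private
    module P = KeyPairing key (λ {s m s' m'} → key-injective {s} {m} {s'} {m'})
                              (λ {s s' m} → key-monoˡ {s} {s'} {m}) (λ {s m m'} → key-monoʳ {s} {m} {m'})

  cornerPairing : MonotonePairing k K
  cornerPairing = P.pairing

  cornerPairing-corner : toℕ (MonotonePairing.to cornerPairing a b) < suc (toℕ a) * suc (toℕ b)
  cornerPairing-corner = ≤-<-trans (P.to≤key a b) key-corner
    where
    key-corner : key a b < A * suc (toℕ b)
    key-corner with inCorner? a b
    ... | yes _    = m*n+o<m*[1+n] A ≤-refl
    ... | no outer = contradiction (≤-refl , ≤-refl) outer

opposite-antimono : ∀ {N} {i j : Fin N} → i Fin.< j → opposite j Fin.< opposite i
opposite-antimono {suc N} {i} {j} i<j =
  subst₂ _<_ (sym (Fin.opposite-prop j)) (sym (Fin.opposite-prop i)) (∸-monoʳ-< (s<s i<j) (toℕ<n j))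

suc-toℕ-opposite : ∀ {N} (i : Fin N) → suc (toℕ (opposite i)) ≡ N ∸ toℕ i
suc-toℕ-opposite i = trans (cong suc (Fin.opposite-prop i)) (sym (+-∸-assoc 1 (toℕ<n i)))

oppositePairing : ∀ {k K} → MonotonePairing k K → MonotonePairing k K
oppositePairing {k} {K} E = record
  { to      = to′
  ; from    = from′
  ; from-to = from′-to′
  ; to-from = to′-from′
  ; monoˡ   = opposite-antimono ∘ E.monoˡ ∘ opposite-antimono
  ; monoʳ   = opposite-antimono ∘ E.monoʳ ∘ opposite-antimono
  }
  where
  module E = MonotonePairing E
  open ≡-Reasoning
  to′ : Fin k → Fin K → Fin (k * K)
  to′ s m = opposite (E.to (opposite s) (opposite m))
  from′ : Fin (k * K) → Fin k × Fin K
  from′ c = Data.Product.map opposite opposite (E.from (opposite c))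
  from′-to′ : ∀ s m → from′ (to′ s m) ≡ (s , m)
  from′-to′ s m = begin
    from′ (to′ s m)
      ≡⟨ cong (Data.Product.map opposite opposite ∘ E.from) (Fin.opposite-involutive _) ⟩
    Data.Product.map opposite opposite (E.from (E.to (opposite s) (opposite m)))
      ≡⟨ cong (Data.Product.map opposite opposite) (E.from-to _ _) ⟩
    (opposite (opposite s) , opposite (opposite m))
      ≡⟨ cong₂ _,_ (Fin.opposite-involutive s) (Fin.opposite-involutive m) ⟩
    (s , m) ∎
  to′-from′ : ∀ c → uncurry to′ (from′ c) ≡ c
  to′-from′ c = begin
    opposite (E.to (opposite (opposite s)) (opposite (opposite m)))
      ≡⟨ cong opposite (cong₂ E.to (Fin.opposite-involutive s) (Fin.opposite-involutive m)) ⟩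
    opposite (E.to s m)            ≡⟨ cong opposite (E.to-from (opposite c)) ⟩
    opposite (opposite c)          ≡⟨ Fin.opposite-involutive c ⟩
    c                              ∎
    where
    s = proj₁ (E.from (opposite c))
    m = proj₂ (E.from (opposite c))

_⊑_ : List X → List X → Set
_⊑_ = Prefix _≡_

⊑-refl : {xs : List X} → xs ⊑ xs
⊑-refl {xs = []}     = []
⊑-refl {xs = x ∷ xs} = refl ∷ ⊑-refl

⊑-trans : {xs ys zs : List X} → xs ⊑ ys → ys ⊑ zs → xs ⊑ zs
⊑-trans = Prefix.trans trans

⊑-antisym : {xs ys : List X} → xs ⊑ ys → ys ⊑ xs → xs ≡ ys
⊑-antisym p q = Pointwise-≡⇒≡ (Prefix.antisym (λ eq _ → eq) p q)

⊑-++ : (xs ys : List X) → xs ⊑ (xs ++ ys)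
⊑-++ xs ys = ⊑-refl ++ᵖ ys

∷ʳ-⋢ : (xs : List X) (x : X) → ¬ (xs ++ [ x ]) ⊑ xs
∷ʳ-⋢ xs x p = m+1+n≰m (length xs) (subst (_≤ length xs) (List.length-++ xs) (Prefix.length-mono p))

⊑-∷ʳ⁻ : {w : List X} (u : List X) (r : X) → w ⊑ (u ++ [ r ]) → w ⊑ u ⊎ w ≡ u ++ [ r ]
⊑-∷ʳ⁻ {w = []}    u       r _               = inj₁ []
⊑-∷ʳ⁻ {w = x ∷ w} []      r (refl ∷ [])     = inj₂ refl
⊑-∷ʳ⁻ {w = x ∷ w} (_ ∷ u) r (refl ∷ p) with ⊑-∷ʳ⁻ u r p
... | inj₁ w⊑u = inj₁ (refl ∷ w⊑u)
... | inj₂ eq  = inj₂ (cong (x ∷_) eq)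

⊑-child-unique : ∀ {z : List X} (v : List X) {j s} → (v ++ [ j ]) ⊑ z → (v ++ [ s ]) ⊑ z → j ≡ s
⊑-child-unique []      (refl ∷ _) (refl ∷ _) = refl
⊑-child-unique (_ ∷ v) (refl ∷ p) (refl ∷ q) = ⊑-child-unique v p q

⊑-child : ∀ {z : List X} (v : List X) → v ⊑ z → z ≡ v ⊎ ∃ λ s → (v ++ [ s ]) ⊑ z
⊑-child {z = []}    []      []         = inj₁ refl
⊑-child {z = s ∷ z} []      []         = inj₂ (s , refl ∷ [])
⊑-child             (x ∷ v) (refl ∷ p) with ⊑-child v p
... | inj₁ eq       = inj₁ (cong (x ∷_) eq)
... | inj₂ (s , q)  = inj₂ (s , refl ∷ q)

does-<?-suc : ∀ {a j} → a ≢ j → does (a <? suc j) ≡ does (a <? j)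
does-<?-suc {a} {j} a≢j with toSum (a <? j)
... | inj₁ a<j = trans (dec-true (a <? suc j) (m<n⇒m<1+n a<j)) (sym (dec-true (a <? j) a<j))
... | inj₂ a≮j = trans (dec-false (a <? suc j) (λ a<1+j → Data.Sum.[ a≮j , a≢j ] (m<1+n⇒m<n∨m≡n a<1+j)))
                      (sym (dec-false (a <? j) a≮j))

if-yes : ∀ {P : Set} (p? : Dec P) {x y : X} → P → (if does p? then x else y) ≡ x
if-yes p? p = cong (if_then _ else _) (dec-true p? p)

if-no : ∀ {P : Set} (p? : Dec P) {x y : X} → ¬ P → (if does p? then x else y) ≡ y
if-no p? ¬p = cong (if_then _ else _) (dec-false p? ¬p)

sum-map-≥ : ∀ (f : X → ℕ) {N} (xs : List X) → (∀ {x} → x ∈ xs → N ≤ f x) → length xs * N ≤ sum (map f xs)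
sum-map-≥ f []       _     = z≤n
sum-map-≥ f (x ∷ xs) bound = +-mono-≤ (bound (here refl)) (sum-map-≥ f xs (bound ∘ there))

sum-map-≤ : ∀ (f : X → ℕ) {N} (xs : List X) → (∀ {x} → x ∈ xs → f x ≤ N) → sum (map f xs) ≤ length xs * N
sum-map-≤ f []       _     = z≤n
sum-map-≤ f (x ∷ xs) bound = +-mono-≤ (bound (here refl)) (sum-map-≤ f xs (bound ∘ there))

product-chain : ∀ (w : X → ℕ) (f : List X → ℕ) → (∀ v x → w x * f (v ++ [ x ]) ≤ f v) →
                ∀ v t → product (map w t) * f (v ++ t) ≤ f v
product-chain w f step v []      = ≤-reflexive (trans (*-identityˡ _) (cong f (List.++-identityʳ v)))
product-chain w f step v (x ∷ t) = begin
  w x * product (map w t) * f (v ++ x ∷ t)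
    ≡⟨ *-assoc (w x) _ _ ⟩
  w x * (product (map w t) * f (v ++ x ∷ t))
    ≡⟨ cong (λ u → w x * (product (map w t) * f u)) (List.++-assoc v [ x ] t) ⟨
  w x * (product (map w t) * f ((v ++ [ x ]) ++ t))
    ≤⟨ *-monoʳ-≤ (w x) (product-chain w f step (v ++ [ x ]) t) ⟩
  w x * f (v ++ [ x ])
    ≤⟨ step v x ⟩
  f v
    ∎
  where open ≤-Reasoning

power-chain : ∀ (b : ℕ) (f : List X → ℕ) → (∀ v x → f v < b * suc (f (v ++ [ x ]))) →
              ∀ v t e → b ^ (e + length t) ≤ f v → b ^ e ≤ f (v ++ t)
power-chain b f step v []      e b^e≤fv = subst₂ _≤_ (cong (b ^_) (+-identityʳ e)) (cong f (sym (List.++-identityʳ v))) b^e≤fv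
power-chain b f step v (x ∷ t) e b^e+t≤fv =
  subst (λ u → b ^ e ≤ f u) (List.++-assoc v [ x ] t) (power-chain b f step (v ++ [ x ]) t e child)
  where
  child : b ^ (e + length t) ≤ f (v ++ [ x ])
  child = s≤s⁻¹ (*-cancelˡ-< b _ _ (begin-strict
    b * b ^ (e + length t)      ≡⟨ cong (b ^_) (+-suc e (length t)) ⟨
    b ^ (e + suc (length t))    ≤⟨ b^e+t≤fv ⟩
    f v                         <⟨ step v x ⟩
    b * suc (f (v ++ [ x ]))    ∎))
    where open ≤-Reasoning

module Analysis (k n : ℕ) where

  open ChipFiring k n

  final : ∀ {σ} → Run σ → Config
  final {σ} (done _)   = σ
  final     (fire _ r) = final r

  InSubtree : Config → Pos k → Pred (Chip k n) 0ℓ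
  InSubtree σ w c = w ⊑ σ c

  inSubtree? : ∀ σ w → Decidable (InSubtree σ w)
  inSubtree? σ w c = Prefix.prefix? Fin._≟_ w (σ c)

  module _ {σ σ' : Config} (F : Fire σ σ') where

    open Fire F

    fire-cases : ∀ d → σ' d ≡ σ d ⊎ ∃ λ r → d ≡ f r × σ d ≡ v × σ' d ≡ v ++ [ r ]
    fire-cases d with Fin.any? (λ r → f r Fin.≟ d)
    ... | yes (r , refl) = inj₂ (r , refl , atv r , moved r)
    ... | no ∄r          = inj₁ (rest d (λ r eq → ∄r (r , eq)))

    fire-mono : ∀ {a b} → a Fin.≤ b → f a Fin.≤ f b
    fire-mono a≤b with ≤⇒<⊎≡ a≤b
    ... | inj₁ a<b  = <⇒≤ (incr a<b)
    ... | inj₂ refl = ≤-refl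

    fire-⊑ : ∀ d → σ d ⊑ σ' d
    fire-⊑ d with fire-cases d
    ... | inj₁ eq                 = subst (σ d ⊑_) (sym eq) ⊑-refl
    ... | inj₂ (r , _ , eq , eq') = subst₂ _⊑_ (sym eq) (sym eq') (⊑-++ v [ r ])

    fire-entered : ∀ {w d} → w ⊑ σ' d → w ⊑ σ d ⊎ ∃ λ r → d ≡ f r × w ≡ v ++ [ r ]
    fire-entered {w} {d} w⊑σ'd with fire-cases d
    ... | inj₁ eq = inj₁ (subst (w ⊑_) eq w⊑σ'd)
    ... | inj₂ (r , d≡fr , eq , eq') with ⊑-∷ʳ⁻ v r (subst (w ⊑_) eq' w⊑σ'd)
    ...   | inj₁ w⊑v = inj₁ (subst (w ⊑_) (sym eq) w⊑v)
    ...   | inj₂ w≡  = inj₂ (r , d≡fr , w≡)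

  final-⊑ : ∀ {σ} (r : Run σ) c → σ c ⊑ final r c
  final-⊑ (done _)   c = ⊑-refl
  final-⊑ (fire F r) c = ⊑-trans (fire-⊑ F c) (final-⊑ r c)

  visits⇒ : ∀ {σ} (r : Run σ) c {w} → w ∈ visits r c → σ c ⊑ w × w ⊑ final r c
  visits⇒ (done _)   c (here refl) = ⊑-refl , ⊑-refl
  visits⇒ (fire F r) c (here refl) = ⊑-refl , final-⊑ (fire F r) c
  visits⇒ (fire F r) c (there w∈) = Data.Product.map₁ (⊑-trans (fire-⊑ F c)) (visits⇒ r c w∈)

  visits⇐ : ∀ {σ} (r : Run σ) c {w} → σ c ⊑ w → w ⊑ final r c → w ∈ visits r c
  visits⇐ (done _) c σc⊑w w⊑τc = here (⊑-antisym w⊑τc σc⊑w)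
  visits⇐ {σ} (fire {σ'} F r) c {w} σc⊑w w⊑τc with fire-cases F c
  ... | inj₁ eq = there (visits⇐ r c (subst (_⊑ w) (sym eq) σc⊑w) w⊑τc)
  ... | inj₂ (s , _ , eq , eq') with ⊑-child (σ c) σc⊑w
  ...   | inj₁ w≡σc        = here w≡σc
  ...   | inj₂ (s' , σcs'⊑w) = there (visits⇐ r c σ'c⊑w w⊑τc)
    where
    σ'c≡ : σ' c ≡ σ c ++ [ s ]
    σ'c≡ = trans eq' (cong (_++ [ s ]) (sym eq))
    s'≡s : s' ≡ s
    s'≡s = ⊑-child-unique (σ c) (⊑-trans σcs'⊑w w⊑τc) (subst (_⊑ final r c) σ'c≡ (final-⊑ r c))
    σ'c⊑w : σ' c ⊑ w
    σ'c⊑w = subst (_⊑ w) (trans (cong (λ x → σ c ++ [ x ]) s'≡s) (sym σ'c≡)) σcs'⊑w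

  arrives⇒ : (r : Run initial) {c : Chip k n} {t : Pos k} → Arrives r c t → t ⊑ final r c
  arrives⇒ r {c} arrives = proj₂ (visits⇒ r c arrives)

  arrives⇐ : (r : Run initial) {c : Chip k n} {t : Pos k} → t ⊑ final r c → Arrives r c t
  arrives⇐ r {c} = visits⇐ r c []

  -- φ pairs each chip that entered child j of v with the chip that the same firing sent
  -- to child s.
  record SiblingInjection (σ : Config) (v : Pos k) (j s : Fin k) : Set where
    field
      φ           : Chip k n → Chip k n
      φ-into      : ∀ {c} → InSubtree σ (v ++ [ j ]) c → InSubtree σ (v ++ [ s ]) (φ c)
      φ-≤         : ∀ {c} → InSubtree σ (v ++ [ j ]) c → s Fin.≤ j → φ c Fin.≤ c
      φ-≥         : ∀ {c} → InSubtree σ (v ++ [ j ]) c → j Fin.≤ s → c Fin.≤ φ c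
      φ-injective : ∀ {c d} → InSubtree σ (v ++ [ j ]) c → InSubtree σ (v ++ [ j ]) d → φ c ≡ φ d → c ≡ d

  Invariant : Config → Set
  Invariant σ = ∀ v j s → SiblingInjection σ v j s

  invariant-initial : Invariant initial
  invariant-initial v j s = record
    { φ           = id
    ; φ-into      = λ c∈ → ⊥-elim (empty c∈)
    ; φ-≤         = λ c∈ → ⊥-elim (empty c∈)
    ; φ-≥         = λ c∈ → ⊥-elim (empty c∈)
    ; φ-injective = λ c∈ → ⊥-elim (empty c∈)
    }
    where
    empty : ¬ (v ++ [ j ]) ⊑ []
    empty v++j⊑[] = ∷ʳ-⋢ v j (⊑-trans v++j⊑[] [])

  module _ {σ σ' : Config} (F : Fire σ σ') where

    open Fire F renaming (v to u)

    fire-elsewhere : ∀ {v j s} → v ≢ u → SiblingInjection σ v j s → SiblingInjection σ' v j s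
    fire-elsewhere {v} {j} {s} v≢u I = record
      { φ           = φ
      ; φ-into      = λ c∈ → ⊑-trans (φ-into (old c∈)) (fire-⊑ F _)
      ; φ-≤         = φ-≤ ∘ old
      ; φ-≥         = φ-≥ ∘ old
      ; φ-injective = λ c∈ d∈ → φ-injective (old c∈) (old d∈)
      }
      where
      open SiblingInjection I
      old : ∀ {c} → InSubtree σ' (v ++ [ j ]) c → InSubtree σ (v ++ [ j ]) c
      old c∈ with fire-entered F c∈
      ... | inj₁ c∈σ            = c∈σ
      ... | inj₂ (_ , _ , eq)   = contradiction (List.∷ʳ-injectiveˡ v u eq) v≢u

    fire-here : ∀ {j s} → SiblingInjection σ u j s → SiblingInjection σ' u j s
    fire-here {j} {s} I = record
      { φ = φ′ ; φ-into = φ′-into ; φ-≤ = φ′-≤ ; φ-≥ = φ′-≥ ; φ-injective = φ′-injective }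
      where
      open SiblingInjection I

      φ′ : Chip k n → Chip k n
      φ′ c with c Fin.≟ f j
      ... | yes _ = f s
      ... | no _  = φ c

      old : ∀ {c} → InSubtree σ' (u ++ [ j ]) c → c ≢ f j → InSubtree σ (u ++ [ j ]) c
      old c∈ c≢fj with fire-entered F c∈
      ... | inj₁ c∈σ                = c∈σ
      ... | inj₂ (r , c≡fr , eq)    = contradiction (trans c≡fr (cong f (sym (List.∷ʳ-injectiveʳ u u eq)))) c≢fj

      old-image≢fs : ∀ {c} → InSubtree σ (u ++ [ j ]) c → φ c ≢ f s
      old-image≢fs c∈ eq = ∷ʳ-⋢ u s (subst ((u ++ [ s ]) ⊑_) (trans (cong σ eq) (atv s)) (φ-into c∈))

      φ′-into : ∀ {c} → InSubtree σ' (u ++ [ j ]) c → InSubtree σ' (u ++ [ s ]) (φ′ c)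
      φ′-into {c} c∈ with c Fin.≟ f j
      ... | yes _    = subst ((u ++ [ s ]) ⊑_) (sym (moved s)) ⊑-refl
      ... | no c≢fj  = ⊑-trans (φ-into (old c∈ c≢fj)) (fire-⊑ F _)

      φ′-≤ : ∀ {c} → InSubtree σ' (u ++ [ j ]) c → s Fin.≤ j → φ′ c Fin.≤ c
      φ′-≤ {c} c∈ s≤j with c Fin.≟ f j
      ... | yes refl = fire-mono F s≤j
      ... | no c≢fj  = φ-≤ (old c∈ c≢fj) s≤j

      φ′-≥ : ∀ {c} → InSubtree σ' (u ++ [ j ]) c → j Fin.≤ s → c Fin.≤ φ′ c
      φ′-≥ {c} c∈ j≤s with c Fin.≟ f j
      ... | yes refl = fire-mono F j≤s
      ... | no c≢fj  = φ-≥ (old c∈ c≢fj) j≤s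

      φ′-injective : ∀ {c d} → InSubtree σ' (u ++ [ j ]) c → InSubtree σ' (u ++ [ j ]) d → φ′ c ≡ φ′ d → c ≡ d
      φ′-injective {c} {d} c∈ d∈ eq with c Fin.≟ f j | d Fin.≟ f j
      ... | yes c≡ | yes d≡ = trans c≡ (sym d≡)
      ... | yes _  | no d≢  = contradiction (sym eq) (old-image≢fs (old d∈ d≢))
      ... | no c≢  | yes _  = contradiction eq (old-image≢fs (old c∈ c≢))
      ... | no c≢  | no d≢  = φ-injective (old c∈ c≢) (old d∈ d≢) eq

  invariant-fire : ∀ {σ σ'} → Fire σ σ' → Invariant σ → Invariant σ'
  invariant-fire F inv v j s with v ≟P Fire.v F
  ... | yes refl = fire-here F (inv v j s)
  ... | no v≢u   = fire-elsewhere F v≢u (inv v j s)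

  invariant-final : ∀ {σ} → Invariant σ → (r : Run σ) → Invariant (final r)
  invariant-final inv (done _)   = inv
  invariant-final inv (fire F r) = invariant-final (invariant-fire F inv) r

  stable-final : ∀ {σ} (r : Run σ) → Stable (final r)
  stable-final (done stable) = stable
  stable-final (fire _ r)    = stable-final r

  module Landing (r : Run initial) where

    private
      τ : Config
      τ = final r

      inv : Invariant τ
      inv = invariant-final invariant-initial r

    subtreeCount : {P : Pred (Chip k n) 0ℓ} → Decidable P → Pos k → ℕ
    subtreeCount P? w = count (inSubtree? τ w ∩? P?)

    sibling-count≤ : ∀ {P} (P? : Decidable P) v {j s} →
                     (∀ {c} → InSubtree τ (v ++ [ j ]) c → P c → P (SiblingInjection.φ (inv v j s) c)) →
                     subtreeCount P? (v ++ [ j ]) ≤ subtreeCount P? (v ++ [ s ])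
    sibling-count≤ P? v {j} {s} preserves =
      count-injection _ _ φ (λ (c∈ , Pc) → φ-into c∈ , preserves c∈ Pc) (λ (c∈ , _) (d∈ , _) → φ-injective c∈ d∈)
      where open SiblingInjection (inv v j s)

    InChildren : Pos k → List (Fin k) → Pred (Chip k n) 0ℓ
    InChildren v ss d = Any (λ s → InSubtree τ (v ++ [ s ]) d) ss

    inChildren? : ∀ v ss → Decidable (InChildren v ss)
    inChildren? v ss d = Any.any? (λ s → inSubtree? τ (v ++ [ s ]) d) ss

    children⊆subtree : ∀ v {ss} → InChildren v ss ⊆ InSubtree τ v
    children⊆subtree v d∈ with s , vs⊑ ← Any.satisfied d∈ = ⊑-trans (⊑-++ v [ s ]) vs⊑

    count-children : ∀ {P} (P? : Decidable P) v {ss} → Unique ss →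
                     count (inChildren? v ss ∩? P?) ≡ sum (map (λ s → subtreeCount P? (v ++ [ s ])) ss)
    count-children P? v {[]}     []                = count-none (inChildren? v [] ∩? P?) (λ { _ (() , _) })
    count-children {P} P? v {s ∷ ss} (s∉ss ∷ unique) =
      trans (count-partition (inChildren? v (s ∷ ss) ∩? P?) (inSubtree? τ (v ++ [ s ]) ∩? P?) (inChildren? v ss ∩? P?)
                             (split , join) disjoint)
            (cong (subtreeCount P? (v ++ [ s ]) +_) (count-children P? v unique))
      where
      split : InChildren v (s ∷ ss) ∩ P ⊆ (InSubtree τ (v ++ [ s ]) ∩ P) ∪ (InChildren v ss ∩ P)
      split (here d∈ , Pd)  = inj₁ (d∈ , Pd)
      split (there d∈ , Pd) = inj₂ (d∈ , Pd)
      join : (InSubtree τ (v ++ [ s ]) ∩ P) ∪ (InChildren v ss ∩ P) ⊆ InChildren v (s ∷ ss) ∩ P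
      join (inj₁ (d∈ , Pd)) = here d∈ , Pd
      join (inj₂ (d∈ , Pd)) = there d∈ , Pd
      disjoint : ∀ {d} → (InSubtree τ (v ++ [ s ]) ∩ P) d → (InChildren v ss ∩ P) d → ⊥
      disjoint (d∈ , _) (d∈′ , _) with s≢s′ , d∈s′ ← All.lookupAny s∉ss d∈′ =
        s≢s′ (⊑-child-unique v d∈ d∈s′)

    filtered-children≤ : ∀ {P A} (P? : Decidable P) (A? : Decidable A) v j →
                         (∀ {s} → A s → subtreeCount P? (v ++ [ j ]) ≤ subtreeCount P? (v ++ [ s ])) →
                         count A? * subtreeCount P? (v ++ [ j ]) ≤ subtreeCount P? v
    filtered-children≤ P? A? v j bound = begin
      count A? * subtreeCount P? (v ++ [ j ])
        ≡⟨ cong (_* _) (length-filter-allFin A?) ⟨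
      length ss * subtreeCount P? (v ++ [ j ])
        ≤⟨ sum-map-≥ _ ss (λ s∈ → bound (proj₂ (∈-filter⁻ A? {xs = allFin k} s∈))) ⟩
      sum (map (λ s → subtreeCount P? (v ++ [ s ])) ss)
        ≡⟨ count-children P? v (Unique.filter⁺ A? (Unique.allFin⁺ k)) ⟨
      count (inChildren? v ss ∩? P?)
        ≤⟨ count-mono (inChildren? v ss ∩? P?) (inSubtree? τ v ∩? P?) (Data.Product.map₁ (children⊆subtree v)) ⟩
      subtreeCount P? v
        ∎
      where
      open ≤-Reasoning
      ss = filter A? (allFin k)

    lower-step : ∀ {P} (P? : Decidable P) → (∀ {c d} → P c → d Fin.≤ c → P d) →
                 ∀ v j → suc (toℕ j) * subtreeCount P? (v ++ [ j ]) ≤ subtreeCount P? v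
    lower-step P? down-closed v j =
      subst (λ m → m * subtreeCount P? (v ++ [ j ]) ≤ subtreeCount P? v) (count-atMost j)
        (filtered-children≤ P? (Fin._≤? j) v j (λ {s} s≤j → sibling-count≤ P? v
          (λ c∈ Pc → down-closed Pc (SiblingInjection.φ-≤ (inv v j s) c∈ s≤j))))

    upper-step : ∀ {P} (P? : Decidable P) → (∀ {c d} → P c → c Fin.≤ d → P d) →
                 ∀ v j → (k ∸ toℕ j) * subtreeCount P? (v ++ [ j ]) ≤ subtreeCount P? v
    upper-step P? up-closed v j =
      subst (λ m → m * subtreeCount P? (v ++ [ j ]) ≤ subtreeCount P? v) (count-atLeast j)
        (filtered-children≤ P? (j Fin.≤?_) v j (λ {s} j≤s → sibling-count≤ P? v
          (λ c∈ Pc → up-closed Pc (SiblingInjection.φ-≥ (inv v j s) c∈ j≤s))))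

    size-step : ∀ v j → subtreeCount U? v < k * suc (subtreeCount U? (v ++ [ j ]))
    size-step v j = begin-strict
      subtreeCount U? v
        ≡⟨ count-partition (inSubtree? τ v ∩? U?) (λ d → τ d ≟P v) (inChildren? v (allFin k) ∩? U?)
                           (split , join) disjoint ⟩
      count (λ d → τ d ≟P v) + count (inChildren? v (allFin k) ∩? U?)
        <⟨ +-monoˡ-< _ (subst (_< k) (length-filter-allFin (λ d → τ d ≟P v)) (stable-final r v)) ⟩
      k + count (inChildren? v (allFin k) ∩? U?)
        ≡⟨ cong (k +_) (count-children U? v (Unique.allFin⁺ k)) ⟩
      k + sum (map (λ s → subtreeCount U? (v ++ [ s ])) (allFin k))
        ≤⟨ +-monoʳ-≤ k (sum-map-≤ _ (allFin k) (λ _ → sibling-count≤ U? v (λ _ _ → _))) ⟩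
      k + length (allFin k) * subtreeCount U? (v ++ [ j ])
        ≡⟨ cong (λ l → k + l * subtreeCount U? (v ++ [ j ])) (List.length-tabulate {n = k} id) ⟩
      k + k * subtreeCount U? (v ++ [ j ])
        ≡⟨ *-suc k _ ⟨
      k * suc (subtreeCount U? (v ++ [ j ]))
        ∎
      where
      open ≤-Reasoning
      split : InSubtree τ v ∩ U ⊆ (λ d → τ d ≡ v) ∪ (InChildren v (allFin k) ∩ U)
      split (v⊑τd , _) with ⊑-child v v⊑τd
      ... | inj₁ τd≡v    = inj₁ τd≡v
      ... | inj₂ (s , q) = inj₂ (Any.map (λ { refl → q }) (∈-allFin s) , _)
      join : (λ d → τ d ≡ v) ∪ (InChildren v (allFin k) ∩ U) ⊆ InSubtree τ v ∩ U
      join (inj₁ τd≡v)    = subst (v ⊑_) (sym τd≡v) ⊑-refl , _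
      join (inj₂ (d∈ , _)) = children⊆subtree v d∈ , _
      disjoint : ∀ {d} → τ d ≡ v → (InChildren v (allFin k) ∩ U) d → ⊥
      disjoint τd≡v (d∈ , _) with s , vs⊑ ← Any.satisfied d∈ = ∷ʳ-⋢ v s (subst ((v ++ [ s ]) ⊑_) τd≡v vs⊑)

    subtree-size : ∀ t → length t ≤ n → k ^ (n ∸ length t) ≤ subtreeCount U? t
    subtree-size t t≤n = power-chain k (subtreeCount U?) size-step [] t (n ∸ length t) (≤-reflexive (begin
      k ^ (n ∸ length t + length t)  ≡⟨ cong (k ^_) (m∸n+n≡m t≤n) ⟩
      k ^ n                          ≡⟨ count-all (inSubtree? τ [] ∩? U?) (λ _ → [] , _) ⟨
      subtreeCount U? []             ∎))
      where open ≡-Reasoning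

    arrivalsBelow≡ : ∀ t c → arrivalsBelow r t c ≡ subtreeCount (Fin._<? c) t
    arrivalsBelow≡ t c =
      trans (length-filter-allFin {k ^ n} _)
            (count-cong {k ^ n} _ (inSubtree? τ t ∩? (Fin._<? c))
                        ((λ (d<c , arrives) → arrives⇒ r arrives , d<c) , (λ (t⊑ , d<c) → d<c , arrives⇐ r t⊑)))

    landing-count : ∀ {t x c} → LandsAt r t x c → subtreeCount (Fin._≤? c) t ≡ x
    landing-count {t} {x} {c} (arrives , below≡) = begin
      subtreeCount (Fin._≤? c) t
        ≡⟨ count-partition _ (inSubtree? τ t ∩? (Fin._<? c)) (inSubtree? τ t ∩? (Fin._≟ c))
                           (split , join) (λ (_ , d<c) (_ , d≡c) → <⇒≢ d<c (cong toℕ d≡c)) ⟩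
      subtreeCount (Fin._<? c) t + subtreeCount (Fin._≟ c) t
        ≡⟨ cong₂ _+_ (arrivalsBelow≡ t c) (sym only-c) ⟨
      arrivalsBelow r t c + 1
        ≡⟨ +-comm _ 1 ⟩
      suc (arrivalsBelow r t c)
        ≡⟨ below≡ ⟩
      x ∎
      where
      open ≡-Reasoning
      split : InSubtree τ t ∩ (Fin._≤ c) ⊆ (InSubtree τ t ∩ (Fin._< c)) ∪ (InSubtree τ t ∩ (_≡ c))
      split (t⊑ , d≤c) = Data.Sum.map (t⊑ ,_) (t⊑ ,_) (≤⇒<⊎≡ d≤c)
      join : (InSubtree τ t ∩ (Fin._< c)) ∪ (InSubtree τ t ∩ (_≡ c)) ⊆ InSubtree τ t ∩ (Fin._≤ c)
      join (inj₁ (t⊑ , d<c)) = t⊑ , <⊎≡⇒≤ (inj₁ d<c)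
      join (inj₂ (t⊑ , d≡c)) = t⊑ , <⊎≡⇒≤ (inj₂ d≡c)
      only-c : subtreeCount (Fin._≟ c) t ≡ 1
      only-c = trans (count-cong _ (Fin._≟ c) (proj₂ , λ { refl → arrives⇒ r arrives , refl })) (count-single c)

    landing-lower : ∀ {t x c} → LandsAt r t x c → product (map (suc ∘ toℕ) t) * x ≤ suc (toℕ c)
    landing-lower {t} {x} {c} lands =
      subst₂ _≤_ (cong (product (map (suc ∘ toℕ) t) *_) (landing-count lands)) root
        (product-chain (suc ∘ toℕ) (subtreeCount (Fin._≤? c))
                       (lower-step (Fin._≤? c) (λ d≤c e≤d → ≤-trans e≤d d≤c)) [] t)
      where
      root : subtreeCount (Fin._≤? c) [] ≡ suc (toℕ c)
      root = trans (count-cong (inSubtree? τ [] ∩? (Fin._≤? c)) (Fin._≤? c) (proj₂ , ([] ,_))) (count-atMost c)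

    landing-upper : ∀ {t x c} → length t ≤ n → LandsAt r t x c →
                    product (map (λ s → k ∸ toℕ s) t) * (k ^ (n ∸ length t) + 1 ∸ x) ≤ k ^ n ∸ toℕ c
    landing-upper {t} {x} {c} t≤n lands@(_ , below≡) = begin
      product (map (λ s → k ∸ toℕ s) t) * (k ^ (n ∸ length t) + 1 ∸ x)
        ≤⟨ *-monoʳ-≤ (product (map (λ s → k ∸ toℕ s) t)) atLeast-c ⟩
      product (map (λ s → k ∸ toℕ s) t) * subtreeCount (c Fin.≤?_) t
        ≤⟨ product-chain _ (subtreeCount (c Fin.≤?_)) (upper-step (c Fin.≤?_) ≤-trans) [] t ⟩
      subtreeCount (c Fin.≤?_) []
        ≡⟨ trans (count-cong (inSubtree? τ [] ∩? (c Fin.≤?_)) (c Fin.≤?_) (proj₂ , ([] ,_))) (count-atLeast c) ⟩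
      k ^ n ∸ toℕ c ∎
      where
      open ≤-Reasoning
      below = subtreeCount (Fin._<? c) t
      size≡ : subtreeCount U? t ≡ below + subtreeCount (c Fin.≤?_) t
      size≡ = count-partition _ (inSubtree? τ t ∩? (Fin._<? c)) (inSubtree? τ t ∩? (c Fin.≤?_))
                ((λ {d} (t⊑ , _) → Data.Sum.map (t⊑ ,_) (t⊑ ,_) (<⊎≥ d c)) ,
                 λ { (inj₁ (t⊑ , _)) → t⊑ , _ ; (inj₂ (t⊑ , _)) → t⊑ , _ })
                (λ (_ , d<c) (_ , c≤d) → <⇒≱ d<c c≤d)
      x≡ : x ≡ suc below
      x≡ = trans (sym below≡) (cong suc (arrivalsBelow≡ t c))
      atLeast-c : k ^ (n ∸ length t) + 1 ∸ x ≤ subtreeCount (c Fin.≤?_) t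
      atLeast-c = subst (λ y → k ^ (n ∸ length t) + 1 ∸ y ≤ subtreeCount (c Fin.≤?_) t) (sym x≡)
        (subst (_≤ subtreeCount (c Fin.≤?_) t) (cong (_∸ suc below) (+-comm 1 (k ^ (n ∸ length t))))
          (m≤n+o⇒m∸n≤o _ below (≤-trans (subtree-size t t≤n) (≤-reflexive size≡))))

module Strategies (k : ℕ) where

  -- In node E S the root fires k ^ m times; its x-th firing sends the chip
  -- to E s x to child s, where it is the x-th of the chips that S s then plays.
  data Strategy : ℕ → Set where
    leaf : Strategy 0
    node : ∀ {m} → MonotonePairing k (k ^ m) → (Fin k → Strategy m) → Strategy (suc m)

  open MonotonePairing

  destination : ∀ {m} → Strategy m → Fin (k ^ m) → Pos k
  destination leaf       _ = []
  destination (node E S) c = proj₁ (from E c) ∷ destination (S (proj₁ (from E c))) (proj₂ (from E c))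

  destination-to : ∀ {m} (E : MonotonePairing k (k ^ m)) (S : Fin k → Strategy m) s x →
                   destination (node E S) (to E s x) ≡ s ∷ destination (S s) x
  destination-to E S s x rewrite from-to E s x = refl

  destination-injective : ∀ {m} (S : Strategy m) → Injective _≡_ _≡_ (destination S)
  destination-injective leaf       {zero} {zero} _ = refl
  destination-injective (node E S) {c} {d} eq with from E c in c≡ | from E d in d≡
  ... | s , x | s′ , x′ with refl , rest ← List.∷-injective eq with refl ← destination-injective (S s) rest =
    from-injective E (trans c≡ (sym d≡))

  chipAt : ∀ {m} → Strategy m → (t : Pos k) → Fin (k ^ (m ∸ length t)) → Fin (k ^ m)
  chipAt S          []      ρ = ρ
  chipAt leaf       (_ ∷ _) ρ = ρ
  chipAt (node E S) (s ∷ t) ρ = to E s (chipAt (S s) t ρ)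

  chipAt-arrives : ∀ {m} (S : Strategy m) t ρ → length t ≤ m → t ⊑ destination S (chipAt S t ρ)
  chipAt-arrives S          []      ρ _         = []
  chipAt-arrives (node E S) (s ∷ t) ρ (s≤s t≤m) rewrite destination-to E S s (chipAt (S s) t ρ) =
    refl ∷ chipAt-arrives (S s) t ρ t≤m

  Reaches : ∀ {m} → Strategy m → Pos k → Pred (Fin (k ^ m)) 0ℓ
  Reaches S t c = t ⊑ destination S c

  reaches? : ∀ {m} (S : Strategy m) t → Decidable (Reaches S t)
  reaches? S t c = Prefix.prefix? Fin._≟_ t (destination S c)

  reaches-child : ∀ {m} (E : MonotonePairing k (k ^ m)) (S : Fin k → Strategy m) {s t c} →
                  Reaches (node E S) (s ∷ t) c → c ≡ to E s (proj₂ (from E c)) × Reaches (S s) t (proj₂ (from E c))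
  reaches-child E S {c = c} (refl ∷ reaches) = sym (to-from E c) , reaches

  chipAt-rank : ∀ {m} (S : Strategy m) t ρ → length t ≤ m →
                count ((Fin._<? chipAt S t ρ) ∩? reaches? S t) ≡ toℕ ρ
  chipAt-rank S [] ρ _ = trans (count-cong ((Fin._<? ρ) ∩? reaches? S []) (Fin._<? ρ) (proj₁ , (_, []))) (count-below ρ)
  chipAt-rank {suc m} (node E S) (s ∷ t) ρ (s≤s t≤m) =
    trans (≤-antisym (count-injection P? Q? (proj₂ ∘ from E) P⇒Q P-injective)
                     (count-injection Q? P? (to E s) Q⇒P (λ _ _ → to-injectiveʳ E s)))
          (chipAt-rank (S s) t ρ t≤m)
    where
    g = chipAt (S s) t ρ
    P? = (Fin._<? to E s g) ∩? reaches? (node E S) (s ∷ t)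
    Q? = (Fin._<? g) ∩? reaches? (S s) t
    P⇒Q : ∀ {d} → d Fin.< to E s g × Reaches (node E S) (s ∷ t) d →
          proj₂ (from E d) Fin.< g × Reaches (S s) t (proj₂ (from E d))
    P⇒Q {d} (d<sg , reaches) with d≡ , reaches′ ← reaches-child E S reaches =
      monoʳ⁻¹ E (subst (Fin._< to E s g) d≡ d<sg) , reaches′
    P-injective : ∀ {d d′} → _ → _ → proj₂ (from E d) ≡ proj₂ (from E d′) → d ≡ d′
    P-injective (_ , reaches) (_ , reaches′) eq =
      trans (proj₁ (reaches-child E S reaches)) (trans (cong (to E s) eq) (sym (proj₁ (reaches-child E S reaches′))))
    Q⇒P : ∀ {x} → x Fin.< g × Reaches (S s) t x → to E s x Fin.< to E s g × Reaches (node E S) (s ∷ t) (to E s x)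
    Q⇒P {x} (x<g , reaches) = monoʳ E x<g , subst ((s ∷ t) ⊑_) (sym (destination-to E S s x)) (refl ∷ reaches)

  module _ {m : ℕ} where

    open ChipFiring k m
    open Analysis k m using (final)

    data Firings : Config → Config → Set where
      stop : ∀ {σ σ'} → σ ≗ σ' → Firings σ σ'
      step : ∀ {σ σ₁ σ'} → Fire σ σ₁ → Firings σ₁ σ' → Firings σ σ'

    fire-resp : ∀ {σ₀ σ σ' σ₁} → σ₀ ≗ σ → Fire σ σ' → σ' ≗ σ₁ → Fire σ₀ σ₁
    fire-resp σ₀≗σ F σ'≗σ₁ = record
      { v = v ; f = f ; incr = incr
      ; atv   = λ r → trans (σ₀≗σ (f r)) (atv r)
      ; moved = λ r → trans (sym (σ'≗σ₁ (f r))) (moved r)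
      ; rest  = λ c f≢c → trans (sym (σ'≗σ₁ c)) (trans (rest c f≢c) (sym (σ₀≗σ c)))
      }
      where open Fire F

    _▸_ : ∀ {σ₀ σ σ'} → σ₀ ≗ σ → Firings σ σ' → Firings σ₀ σ'
    σ₀≗σ ▸ stop σ≗σ'  = stop (λ c → trans (σ₀≗σ c) (σ≗σ' c))
    σ₀≗σ ▸ step F fs  = step (fire-resp σ₀≗σ F (λ _ → refl)) fs

    _◅◅_ : ∀ {σ σ₁ σ'} → Firings σ σ₁ → Firings σ₁ σ' → Firings σ σ'
    stop σ≗σ₁ ◅◅ gs = σ≗σ₁ ▸ gs
    step F fs ◅◅ gs = step F (fs ◅◅ gs)

    stable-resp : ∀ {σ σ'} → σ ≗ σ' → Stable σ' → Stable σ
    stable-resp {σ} {σ'} σ≗σ' stable v = subst (_< k) (begin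
      chipsAt σ' v             ≡⟨ length-filter-allFin {k ^ m} _ ⟩
      count (λ c → σ' c ≟P v)  ≡⟨ count-cong {k ^ m} _ (λ c → σ c ≟P v) (trans (σ≗σ' _) , trans (sym (σ≗σ' _))) ⟩
      count (λ c → σ c ≟P v)   ≡⟨ length-filter-allFin {k ^ m} _ ⟨
      chipsAt σ v              ∎) (stable v)
      where open ≡-Reasoning

    toRun : ∀ {σ σ'} → Firings σ σ' → Stable σ' → Run σ
    toRun (stop σ≗σ') stable = done (stable-resp σ≗σ' stable)
    toRun (step F fs) stable = fire F (toRun fs stable)

    final-toRun : ∀ {σ σ'} (fs : Firings σ σ') (stable : Stable σ') → final (toRun fs stable) ≗ σ'
    final-toRun (stop σ≗σ') _      = σ≗σ'
    final-toRun (step _ fs) stable = final-toRun fs stable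

  module Lift {m} (E : MonotonePairing k (k ^ m)) (s : Fin k) (others : ChipFiring.Config k (suc m)) where

    open ChipFiring using (Config; Fire)

    lift : Config k m → Config k (suc m)
    lift σ c = if does (proj₁ (from E c) Fin.≟ s) then s ∷ σ (proj₂ (from E c)) else others c

    lift-to : ∀ σ x → lift σ (to E s x) ≡ s ∷ σ x
    lift-to σ x rewrite from-to E s x = if-yes (s Fin.≟ s) refl

    lift-others : ∀ σ {c} → proj₁ (from E c) ≢ s → lift σ c ≡ others c
    lift-others σ {c} ≢s = if-no (proj₁ (from E c) Fin.≟ s) ≢s

    lift-cong : ∀ {σ σ'} → σ ≗ σ' → lift σ ≗ lift σ'
    lift-cong σ≗σ' c = cong (λ p → if does (proj₁ (from E c) Fin.≟ s) then s ∷ p else others c) (σ≗σ' _)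

    lift-fire : ∀ {σ σ'} → Fire k m σ σ' → Fire k (suc m) (lift σ) (lift σ')
    lift-fire {σ} {σ'} F = record
      { v     = s ∷ v
      ; f     = to E s ∘ f
      ; incr  = monoʳ E ∘ incr
      ; atv   = λ r → trans (lift-to σ (f r)) (cong (s ∷_) (atv r))
      ; moved = λ r → trans (lift-to σ' (f r)) (cong (s ∷_) (moved r))
      ; rest  = rest′
      }
      where
      open Fire F
      rest′ : ∀ c → (∀ r → to E s (f r) ≢ c) → lift σ' c ≡ lift σ c
      rest′ c unfired with toSum (proj₁ (from E c) Fin.≟ s)
      ... | inj₂ ≢s = trans (lift-others σ' ≢s) (sym (lift-others σ ≢s))
      ... | inj₁ ≡s = cong (λ p → if does (proj₁ (from E c) Fin.≟ s) then s ∷ p else others c)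
                        (rest (proj₂ (from E c)) (λ r fr≡ → unfired r (begin
                          to E s (f r)                             ≡⟨ cong₂ (to E) (sym ≡s) fr≡ ⟩
                          to E (proj₁ (from E c)) (proj₂ (from E c)) ≡⟨ to-from E c ⟩
                          c                                        ∎)))
        where open ≡-Reasoning

    lift-firings : ∀ {σ σ'} → Firings {m} σ σ' → Firings {suc m} (lift σ) (lift σ')
    lift-firings (stop σ≗σ') = stop (lift-cong σ≗σ')
    lift-firings (step F fs) = step (lift-fire F) (lift-firings fs)

  -- The root first fires its k ^ m rounds (in B j the chips of index below j have
  -- moved to their child); then the children play one after the other (in C j the
  -- children below j have finished).
  module Phases {m} (E : MonotonePairing k (k ^ m)) (S : Fin k → Strategy m)
                (play : ∀ s → Firings {m} (λ _ → []) (destination (S s))) where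

    open ChipFiring k (suc m) using (Config; Fire)

    child : Fin (k ^ suc m) → Fin k
    child c = proj₁ (from E c)

    index : Fin (k ^ suc m) → Fin (k ^ m)
    index c = proj₂ (from E c)

    B : ℕ → Config
    B j c = if does (toℕ (index c) <? j) then [ child c ] else []

    C : ℕ → Config
    C j c = if does (toℕ (child c) <? j) then destination (node E S) c else [ child c ]

    B-to : ∀ j r x → B j (to E r x) ≡ (if does (toℕ x <? j) then [ r ] else [])
    B-to j r x = cong (λ p → if does (toℕ (proj₂ p) <? j) then [ proj₁ p ] else []) (from-to E r x)

    round : ∀ j → j < k ^ m → Fire (B j) (B (suc j))
    round j j<K = record
      { v     = []
      ; f     = λ r → to E r x
      ; incr  = monoˡ E
      ; atv   = λ r → trans (B-to j r x) (if-no (toℕ x <? j) (λ x<j → n≮n j (subst (_< j) toℕx≡j x<j)))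
      ; moved = λ r → trans (B-to (suc j) r x) (if-yes (toℕ x <? suc j) (≤-reflexive (cong suc toℕx≡j)))
      ; rest  = λ c unfired → cong (λ b → if b then [ child c ] else [])
                                   (does-<?-suc (λ index≡j → unfired (child c) (to-index index≡j)))
      }
      where
      x = fromℕ< j<K
      toℕx≡j : toℕ x ≡ j
      toℕx≡j = toℕ-fromℕ< j<K
      to-index : ∀ {c} → toℕ (index c) ≡ j → to E (child c) x ≡ c
      to-index {c} index≡j = trans (cong (to E (child c)) (toℕ-injective (trans toℕx≡j (sym index≡j)))) (to-from E c)

    root-phase : ∀ j → j ≤ k ^ m → Firings {suc m} (B 0) (B j)
    root-phase zero    _   = stop (λ _ → refl)
    root-phase (suc j) j<K = root-phase j (<⇒≤ j<K) ◅◅ step (round j j<K) (stop (λ _ → refl))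

    child-phase : ∀ j → j < k → Firings {suc m} (C j) (C (suc j))
    child-phase j j<k = (λ c → sym (before c)) ▸ (lift-firings (play s) ◅◅ stop after)
      where
      s = fromℕ< j<k
      toℕs≡j : toℕ s ≡ j
      toℕs≡j = toℕ-fromℕ< j<k
      child≡j : ∀ {c} → child c ≡ s → toℕ (child c) ≡ j
      child≡j ≡s = trans (cong toℕ ≡s) toℕs≡j
      open Lift {m} E s (C j)
      open ≡-Reasoning
      before : ∀ c → lift (λ _ → []) c ≡ C j c
      before c with toSum (child c Fin.≟ s)
      ... | inj₂ ≢s = lift-others (λ _ → []) ≢s
      ... | inj₁ ≡s = begin
        lift (λ _ → []) c  ≡⟨ if-yes (child c Fin.≟ s) ≡s ⟩
        [ s ]              ≡⟨ cong [_] ≡s ⟨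
        [ child c ]        ≡⟨ if-no (toℕ (child c) <? j) (λ lt → n≮n j (subst (_< j) (child≡j ≡s) lt)) ⟨
        C j c              ∎
      after : ∀ c → lift (destination (S s)) c ≡ C (suc j) c
      after c with toSum (child c Fin.≟ s)
      ... | inj₁ ≡s = begin
        lift (destination (S s)) c
          ≡⟨ if-yes (child c Fin.≟ s) ≡s ⟩
        s ∷ destination (S s) (index c)
          ≡⟨ cong (λ s′ → s′ ∷ destination (S s′) (index c)) ≡s ⟨
        child c ∷ destination (S (child c)) (index c)
          ≡⟨ if-yes (toℕ (child c) <? suc j) (≤-reflexive (cong suc (child≡j ≡s))) ⟨
        C (suc j) c
          ∎
      ... | inj₂ ≢s   = trans (lift-others (destination (S s)) ≢s)
                              (cong (λ b → if b then destination (node E S) c else [ child c ])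
                                    (sym (does-<?-suc (λ eq → ≢s (toℕ-injective (trans eq (sym toℕs≡j)))))))

    children-phase : ∀ j → j ≤ k → Firings {suc m} (C 0) (C j)
    children-phase zero    _   = stop (λ _ → refl)
    children-phase (suc j) j<k = children-phase j (<⇒≤ j<k) ◅◅ child-phase j j<k

    firings : Firings {suc m} (λ _ → []) (destination (node E S))
    firings = nothing-moved ▸ (root-phase (k ^ m) ≤-refl ◅◅ (rounds-done ▸ (children-phase k ≤-refl ◅◅ stop all-done)))
      where
      nothing-moved : (λ _ → []) ≗ B 0
      nothing-moved c = sym (if-no (toℕ (index c) <? 0) {x = [ child c ]} n≮0)
      rounds-done : B (k ^ m) ≗ C 0
      rounds-done c = trans (if-yes (toℕ (index c) <? k ^ m) (toℕ<n _))
                            (sym (if-no (toℕ (child c) <? 0) {x = destination (node E S) c} n≮0))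
      all-done : C k ≗ destination (node E S)
      all-done c = if-yes (toℕ (child c) <? k) (toℕ<n _)

  play : ∀ {m} (S : Strategy m) → Firings {m} (λ _ → []) (destination S)
  play leaf       = stop (λ _ → refl)
  play (node E S) = Phases.firings E S (λ s → play (S s))

  module _ (2≤k : 2 ≤ k) {m : ℕ} where

    open ChipFiring k m using (Run; Stable; LandsAt; arrivalsBelow)
    open Analysis k m using (final; arrives⇒; arrives⇐)

    destination-stable : (S : Strategy m) → Stable (destination S)
    destination-stable S v = <-≤-trans (s≤s (subst (_≤ 1) (sym (length-filter-allFin {k ^ m} _))
                               (count-atMostOne _ (λ eq eq′ → destination-injective S (trans eq (sym eq′)))))) 2≤k

    run : Strategy m → Run (λ _ → [])
    run S = toRun (play S) (destination-stable S)

    run-lands : ∀ (S : Strategy m) t ρ → length t ≤ m → LandsAt (run S) t (suc (toℕ ρ)) (chipAt S t ρ)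
    run-lands S t ρ t≤m = arrives⇐ (run S) (reaches-final (chipAt-arrives S t ρ t≤m)) , cong suc (begin
      arrivalsBelow (run S) t (chipAt S t ρ)
        ≡⟨ trans (length-filter-allFin {k ^ m} _)
                 (count-cong {k ^ m} _ ((Fin._<? chipAt S t ρ) ∩? reaches? S t)
                             (Data.Product.map₂ (final-reaches ∘ arrives⇒ (run S)) ,
                              Data.Product.map₂ (arrives⇐ (run S) ∘ reaches-final))) ⟩
      count ((Fin._<? chipAt S t ρ) ∩? reaches? S t)
        ≡⟨ chipAt-rank S t ρ t≤m ⟩
      toℕ ρ ∎)
      where
      open ≡-Reasoning
      reaches-final : ∀ {d} → Reaches S t d → t ⊑ final (run S) d
      reaches-final {d} = subst (t ⊑_) (sym (final-toRun (play S) (destination-stable S) d))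
      final-reaches : ∀ {d} → t ⊑ final (run S) d → Reaches S t d
      final-reaches {d} = subst (t ⊑_) (final-toRun (play S) (destination-stable S) d)

  someStrategy : ∀ m → Fin (k ^ m) → Strategy m
  someStrategy zero    _ = leaf
  someStrategy (suc m) c = node (Corner.cornerPairing a b) (λ _ → someStrategy m b)
    where
    a = proj₁ (remQuot {k} (k ^ m) c)
    b = proj₂ (remQuot {k} (k ^ m) c)

  lowStrategy : ∀ m (t : Pos k) → Fin (k ^ (m ∸ length t)) → Strategy m
  lowStrategy m       []      ρ = someStrategy m ρ
  lowStrategy zero    (_ ∷ _) ρ = leaf
  lowStrategy (suc m) (s ∷ t) ρ = node (Corner.cornerPairing s (chipAt S t ρ)) (λ _ → S)
    where S = lowStrategy m t ρ

  highStrategy : ∀ m (t : Pos k) → Fin (k ^ (m ∸ length t)) → Strategy m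
  highStrategy m       []      ρ = someStrategy m ρ
  highStrategy zero    (_ ∷ _) ρ = leaf
  highStrategy (suc m) (s ∷ t) ρ =
    node (oppositePairing (Corner.cornerPairing (opposite s) (opposite (chipAt S t ρ)))) (λ _ → S)
    where S = highStrategy m t ρ

  lowStrategy-chipAt : ∀ m t ρ → length t ≤ m →
                       suc (toℕ (chipAt (lowStrategy m t ρ) t ρ)) ≤ product (map (suc ∘ toℕ) t) * suc (toℕ ρ)
  lowStrategy-chipAt m       []      ρ _         = ≤-reflexive (sym (*-identityˡ _))
  lowStrategy-chipAt (suc m) (s ∷ t) ρ (s≤s t≤m) = begin
    suc (toℕ (to E s g))
      ≤⟨ Corner.cornerPairing-corner s g ⟩
    suc (toℕ s) * suc (toℕ g)
      ≤⟨ *-monoʳ-≤ (suc (toℕ s)) (lowStrategy-chipAt m t ρ t≤m) ⟩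
    suc (toℕ s) * (product (map (suc ∘ toℕ) t) * suc (toℕ ρ))
      ≡⟨ *-assoc (suc (toℕ s)) (product (map (suc ∘ toℕ) t)) _ ⟨
    product (map (suc ∘ toℕ) (s ∷ t)) * suc (toℕ ρ)
      ∎
    where
    open ≤-Reasoning
    g = chipAt (lowStrategy m t ρ) t ρ
    E = Corner.cornerPairing s g

  highStrategy-chipAt : ∀ m t ρ → length t ≤ m →
                        suc (toℕ (opposite (chipAt (highStrategy m t ρ) t ρ)))
                          ≤ product (map (λ s → k ∸ toℕ s) t) * suc (toℕ (opposite ρ))
  highStrategy-chipAt m       []      ρ _         = ≤-reflexive (sym (*-identityˡ _))
  highStrategy-chipAt (suc m) (s ∷ t) ρ (s≤s t≤m) = begin
    suc (toℕ (opposite (opposite (to E (opposite s) (opposite g)))))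
      ≡⟨ cong (suc ∘ toℕ) (Fin.opposite-involutive _) ⟩
    suc (toℕ (to E (opposite s) (opposite g)))
      ≤⟨ Corner.cornerPairing-corner (opposite s) (opposite g) ⟩
    suc (toℕ (opposite s)) * suc (toℕ (opposite g))
      ≡⟨ cong (_* suc (toℕ (opposite g))) (suc-toℕ-opposite s) ⟩
    (k ∸ toℕ s) * suc (toℕ (opposite g))
      ≤⟨ *-monoʳ-≤ (k ∸ toℕ s) (highStrategy-chipAt m t ρ t≤m) ⟩
    (k ∸ toℕ s) * (product (map (λ s → k ∸ toℕ s) t) * suc (toℕ (opposite ρ)))
      ≡⟨ *-assoc (k ∸ toℕ s) (product (map (λ s → k ∸ toℕ s) t)) _ ⟨
    product (map (λ s → k ∸ toℕ s) (s ∷ t)) * suc (toℕ (opposite ρ))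
      ∎
    where
    open ≤-Reasoning
    g = chipAt (highStrategy m t ρ) t ρ
    E = Corner.cornerPairing (opposite s) (opposite g)

module Extremes {k n : ℕ} (2≤k : 2 ≤ k) where

  open Strategies k
  open ChipFiring k n using (LandsAt)
  open Analysis.Landing k n using (landing-lower; landing-upper)

  least-landing : ∀ t x → length t ≤ n → 1 ≤ x → x ≤ k ^ (n ∸ length t) →
                  Σ (Chip k n) λ a → IsLeast (CanLand k n t x) a × label a ≡ product (map (suc ∘ toℕ) t) * x
  least-landing t (suc x) t≤n _ x<K = a , (a-lands , a-least) , ≤-antisym a-bound (lower a-lands)
    where
    ρ = fromℕ< x<K
    a = chipAt (lowStrategy n t ρ) t ρ
    rank≡ : suc (toℕ ρ) ≡ suc x
    rank≡ = cong suc (toℕ-fromℕ< x<K)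
    a-lands : CanLand k n t (suc x) a
    a-lands = run 2≤k S , subst (λ y → LandsAt (run 2≤k S) t y a) rank≡ (run-lands 2≤k S t ρ t≤n)
      where S = lowStrategy n t ρ
    lower : ∀ {c} → CanLand k n t (suc x) c → product (map (suc ∘ toℕ) t) * suc x ≤ suc (toℕ c)
    lower (r , lands) = landing-lower r lands
    a-bound : suc (toℕ a) ≤ product (map (suc ∘ toℕ) t) * suc x
    a-bound = subst (λ y → suc (toℕ a) ≤ product (map (suc ∘ toℕ) t) * y) rank≡ (lowStrategy-chipAt n t ρ t≤n)
    a-least : ∀ c → CanLand k n t (suc x) c → a Fin.≤ c
    a-least c lands = s≤s⁻¹ (≤-trans a-bound (lower lands))

  greatest-landing : ∀ t x → length t ≤ n → 1 ≤ x → x ≤ k ^ (n ∸ length t) →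
                     Σ (Chip k n) λ b → IsGreatest (CanLand k n t x) b ×
                       k ^ n ∸ toℕ b ≡ product (map (λ s → k ∸ toℕ s) t) * (k ^ (n ∸ length t) + 1 ∸ x)
  greatest-landing t (suc x) t≤n _ x<K = b , (b-lands , b-greatest) , ≤-antisym b-bound (upper b-lands)
    where
    K = k ^ (n ∸ length t)
    Q = product (map (λ s → k ∸ toℕ s) t)
    ρ = fromℕ< x<K
    b = chipAt (highStrategy n t ρ) t ρ
    b-lands : CanLand k n t (suc x) b
    b-lands = run 2≤k S , subst (λ y → LandsAt (run 2≤k S) t y b) (cong suc (toℕ-fromℕ< x<K)) (run-lands 2≤k S t ρ t≤n)
      where S = highStrategy n t ρ
    upper : ∀ {c} → CanLand k n t (suc x) c → Q * (K + 1 ∸ suc x) ≤ k ^ n ∸ toℕ c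
    upper (r , lands) = landing-upper r t≤n lands
    mirrored-rank : suc (toℕ (opposite ρ)) ≡ K + 1 ∸ suc x
    mirrored-rank = trans (suc-toℕ-opposite ρ) (trans (cong (K ∸_) (toℕ-fromℕ< x<K)) (cong (_∸ suc x) (+-comm 1 K)))
    b-bound : k ^ n ∸ toℕ b ≤ Q * (K + 1 ∸ suc x)
    b-bound = subst₂ _≤_ (suc-toℕ-opposite b) (cong (Q *_) mirrored-rank) (highStrategy-chipAt n t ρ t≤n)
    b-greatest : ∀ c → CanLand k n t (suc x) c → c Fin.≤ b
    b-greatest c lands = ∸-cancelʳ-≤ (<⇒≤ (toℕ<n c)) (≤-trans b-bound (upper lands))

product-mirror : ∀ {k} (t : Pos k) → product (map (suc ∘ toℕ) (mirror t)) ≡ product (map (λ s → k ∸ toℕ s) t)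
product-mirror t = cong product (trans (sym (List.map-∘ t)) (List.map-cong suc-toℕ-opposite t))

m+1∸[m∸i]≡1+i : ∀ {N} (i : Fin N) → N + 1 ∸ (N ∸ toℕ i) ≡ suc (toℕ i)
m+1∸[m∸i]≡1+i {N} i = begin
  N + 1 ∸ (N ∸ toℕ i)     ≡⟨ cong (_∸ (N ∸ toℕ i)) (+-comm N 1) ⟩
  suc N ∸ (N ∸ toℕ i)     ≡⟨ +-∸-assoc 1 (m∸n≤m N (toℕ i)) ⟩
  suc (N ∸ (N ∸ toℕ i))   ≡⟨ cong suc (m∸[m∸n]≡n (<⇒≤ (toℕ<n i))) ⟩
  suc (toℕ i)             ∎
  where open ≡-Reasoning

corollary3p5 : (k n : ℕ) → 2 ≤ k → 1 ≤ n →
    (t : List (Fin k)) → 1 ≤ length t → length t ≤ n →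
    (x : ℕ) → 1 ≤ x → x ≤ k ^ (n ∸ length t) →
    Σ (Chip k n) λ a → Σ (Chip k n) λ b →
      IsLeast (CanLand k n (mirror t) (k ^ (n ∸ length t) + 1 ∸ x)) a
      × IsGreatest (CanLand k n t x) b
      × label b ≡ k ^ n + 1 ∸ label a
corollary3p5 k n 2≤k _ t _ t≤n x 1≤x x≤K =
  let a , a-least , a-label    = least-landing (mirror t) x′ (subst (_≤ n) (sym length≡) t≤n) 1≤x′ x′≤K′
      b , b-greatest , b-value = greatest-landing t x t≤n 1≤x x≤K
  in  a , b , a-least , b-greatest , mirror-labels a b a-label b-value
  where
  open Extremes {k} {n} 2≤k
  Q = product (map (λ s → k ∸ toℕ s) t)
  x′ = k ^ (n ∸ length t) + 1 ∸ x
  length≡ : length (mirror t) ≡ length t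
  length≡ = List.length-map opposite t
  1≤x′ : 1 ≤ x′
  1≤x′ = subst (1 ≤_) (sym (+-∸-comm 1 x≤K)) (m≤n+m 1 _)
  x′≤K′ : x′ ≤ k ^ (n ∸ length (mirror t))
  x′≤K′ = subst (λ l → x′ ≤ k ^ (n ∸ l)) (sym length≡) (begin
    x′                                  ≡⟨ +-∸-comm 1 x≤K ⟩
    k ^ (n ∸ length t) ∸ x + 1          ≡⟨ +-comm _ 1 ⟩
    suc (k ^ (n ∸ length t) ∸ x)        ≤⟨ ∸-monoʳ-< 1≤x x≤K ⟩
    k ^ (n ∸ length t)                  ∎)
    where open ≤-Reasoning
  mirror-labels : ∀ a b → label a ≡ product (map (suc ∘ toℕ) (mirror t)) * x′ → k ^ n ∸ toℕ b ≡ Q * x′ →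
                  label b ≡ k ^ n + 1 ∸ label a
  mirror-labels a b a-label b-value = begin
    label b                                                  ≡⟨ m+1∸[m∸i]≡1+i b ⟨
    k ^ n + 1 ∸ (k ^ n ∸ toℕ b)                              ≡⟨ cong (k ^ n + 1 ∸_) b-value ⟩
    k ^ n + 1 ∸ Q * x′                                       ≡⟨ cong (λ p → k ^ n + 1 ∸ p * x′) (product-mirror t) ⟨
    k ^ n + 1 ∸ (product (map (suc ∘ toℕ) (mirror t)) * x′)  ≡⟨ cong (k ^ n + 1 ∸_) a-label ⟨
    k ^ n + 1 ∸ label a                                      ∎
    where open ≡-Reasoning
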